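{- For all $n,s\in\mathbb{N}$, $\mathrm{sat}^{*}\left(n,\mathcal{K}_{s,2}\right)\geq n+1$.
   Context: For $n\in\mathbb{N}$, $[n]=\{1,\dots,n\}$ and $2^{[n]}$ is the family of all subsets of $[n]$. For posets $\mathcal{P}$ and $\mathcal{Q}$, $\mathcal{Q}$ contains an induced copy of $\mathcal{P}$ if there is an injective map $f:\mathcal{P}\to\mathcal{Q}$ with $f(x)\preceq_{\mathcal{Q}}f(y)$ if and only if $x\preceq_{\mathcal{P}}y$. The complete bipartite poset $\mathcal{K}_{s,t}$ consists of $s$ pairwise incomparable elements (upper layer) and $t$ pairwise incomparable elements (lower layer), where every upper element is larger than every lower element, and there are no other relations. A family $\mathcal{F}\subseteq 2^{[n]}$ is induced $\mathcal{P}$-saturated if $(\mathcal{F},\subseteq)$ contains no induced copy of $\mathcal{P}$, but for every $F\in 2^{[n]}\setminus\mathcal{F}$ the poset $(\mathcal{F}\cup\{F\},\subseteq)$ contains an induced copy of $\mathcal{P}$. $\mathrm{sat}^{*}(n,\mathcal{P})$ denotes the minimum size of an induced $\mathcal{P}$-saturated family $\mathcal{F}\subseteq 2^{[n]}$. -}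

module Defs where

open import Data.Nat using (ℕ)
open import Data.Fin using (Fin)
open import Data.Sum using (_⊎_; inj₁; inj₂)
open import Data.Product using (Σ; _×_)
open import Data.List using (List; _∷_)
open import Data.Fin.Subset using (Subset; _⊆_)
import Data.List.Membership.Propositional as L
open import Function.Definitions using (Injective)
open import Function.Bundles using (_⇔_)
open import Relation.Binary.PropositionalEquality using (_≡_)
open import Relation.Nullary using (¬_)

-- Elements of the complete bipartite poset K_{s,t}:
-- inj₁ i = upper element i (i < s), inj₂ j = lower element j (j < t).
KElem : ℕ → ℕ → Set
KElem s t = Fin s ⊎ Fin t

data _≼K_ {s t : ℕ} : KElem s t → KElem s t → Set where
  ≼-refl : ∀ {x} → x ≼K x
  ≼-low-up : ∀ {j : Fin t} {i : Fin s} → inj₂ j ≼K inj₁ i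

-- A family of subsets of [n] = Fin n, given as a list (size = length,
-- duplicates excluded by a Unique hypothesis in the theorem).
Family : ℕ → Set
Family n = List (Subset n)

ContainsInducedK : ∀ {n} → ℕ → ℕ → Family n → Set
ContainsInducedK {n} s t F =
  Σ (KElem s t → Subset n) λ f →
    (∀ x → f x L.∈ F) ×
    Injective _≡_ _≡_ f ×
    (∀ x y → (f x ⊆ f y) ⇔ (x ≼K y))

InducedSaturated : ∀ {n} → ℕ → ℕ → Family n → Set
InducedSaturated {n} s t F =
  ¬ ContainsInducedK s t F ×
  (∀ (A : Subset n) → ¬ (A L.∈ F) → ContainsInducedK s t (A ∷ F))

-- Saturation puts ∅ into F and, for every i ∈ [n], a set Y ∈ F with i ∉ Y and
-- Y ∪ {i} ∈ F such that the members of F below Y ∪ {i} form a chain. Such a Y is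
-- grown from ∅: if Y ∪ {i} ∉ F, adding it creates an induced K_{s,2} in which it
-- is a lower element (its down-set in F is a chain). As F is K_{s,2}-free, the
-- members of F below the union of the two lowers form a chain, and this makes the
-- other lower a strictly larger valid Y. The sets ∅ and Y_i ∪ {i} are n + 1
-- distinct members of F: two Y's below a common set are comparable.
module Submission where

open import Defs
open import Data.Nat using (ℕ; suc; _≤_)
open import Data.List using (length)
open import Data.List.Relation.Unary.Unique.Propositional using (Unique)

open import Data.Bool using () renaming (_≟_ to _≟ᵇ_)
open import Data.Empty using (⊥-elim)
open import Data.Fin using (Fin; zero; suc)
open import Data.Fin.Properties using (any?; injective⇒≤)
open import Data.Fin.Subset
  using (Subset; _⊆_; _⊈_; _⊂_; _⊃_; _∪_; ⁅_⁆) renaming (⊥ to ∅; _∈_ to _∈ₛ_; _∉_ to _∉ₛ_)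
open import Data.Fin.Subset.Properties
  using (_∈?_; _⊆?_; ⊆-refl; ⊆-reflexive; ⊆-min; ∉⊥; x∈⁅x⁆; x∈⁅y⁆⇒x≡y;
         p⊆p∪q; q⊆p∪q; x∈p∪q⁺; x∈p∪q⁻; ∪-identityˡ)
open import Data.Fin.Subset.Induction using (⊃-wellFounded; acc)
open import Induction.WellFounded using (Acc)
open import Data.List using (List; _∷_; lookup)
import Data.List.Relation.Unary.Any as Any
open import Data.List.Relation.Unary.Any.Properties using (lookup-index)
open import Data.List.Membership.Propositional using (_∈_; _∉_)
open import Data.Product using (_×_; _,_; ∃; proj₁; proj₂)
open import Data.Sum using (_⊎_; inj₁; inj₂; [_,_]′)
open import Data.Sum.Properties using (inj₂-injective)
open import Data.Vec.Properties using (≡-dec)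
open import Function using (_∘_)
open import Function.Bundles using (_⇔_; mk⇔; Equivalence)
open import Function.Definitions using (Injective)
open import Relation.Binary.Definitions using (DecidableEquality)
open import Relation.Nullary using (¬_; ¬?; Dec; yes; no)
open import Relation.Nullary.Decidable using (_×-dec_)
open import Relation.Binary.PropositionalEquality
  using (_≡_; _≢_; refl; sym; cong; subst; module ≡-Reasoning)

private
  variable
    m n s t : ℕ
    A : Set
    i j : Fin n
    p q r : Subset n

open Equivalence using (to; from)

_≟ₛ_ : DecidableEquality (Subset n)
_≟ₛ_ = ≡-dec _≟ᵇ_

_∈ᶠ?_ : (p : Subset n) (F : Family n) → Dec (p ∈ F)
p ∈ᶠ? F = Any.any? (p ≟ₛ_) F

Comparable : Subset n → Subset n → Set
Comparable p q = p ⊆ q ⊎ q ⊆ p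

∪-least : p ⊆ r → q ⊆ r → p ∪ q ⊆ r
∪-least {p = p} {q = q} p⊆r q⊆r x∈p∪q with x∈p∪q⁻ p q x∈p∪q
... | inj₁ x∈p = p⊆r x∈p
... | inj₂ x∈q = q⊆r x∈q

⊈⇒∃∈∉ : p ⊈ q → ∃ λ x → x ∈ₛ p × x ∉ₛ q
⊈⇒∃∈∉ {p = p} {q = q} p⊈q with any? (λ x → (x ∈? p) ×-dec ¬? (x ∈? q))
... | yes witness = witness
... | no ∄witness = ⊥-elim (p⊈q p⊆q)
  where
  p⊆q : p ⊆ q
  p⊆q {x} x∈p with x ∈? q
  ... | yes x∈q = x∈q
  ... | no x∉q = ⊥-elim (∄witness (x , x∈p , x∉q))

⊆⁅⁆⇒comparable : p ⊆ ⁅ i ⁆ → q ⊆ ⁅ i ⁆ → Comparable p q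
⊆⁅⁆⇒comparable {p = p} {i = i} p⊆i q⊆i with i ∈? p
... | yes i∈p = inj₂ λ x∈q → subst (_∈ₛ p) (sym (x∈⁅y⁆⇒x≡y i (q⊆i x∈q))) i∈p
... | no i∉p = inj₁ λ x∈p → ⊥-elim (i∉p (subst (_∈ₛ p) (x∈⁅y⁆⇒x≡y i (p⊆i x∈p)) x∈p))

x∈p∪⁅x⁆ : ∀ (p : Subset n) i → i ∈ₛ p ∪ ⁅ i ⁆
x∈p∪⁅x⁆ p i = x∈p∪q⁺ (inj₂ (x∈⁅x⁆ i))

∪⁅⁆≡∪⁅⁆⇒≡ : j ∉ₛ q → p ⊆ q → p ∪ ⁅ i ⁆ ≡ q ∪ ⁅ j ⁆ → i ≡ j
∪⁅⁆≡∪⁅⁆⇒≡ {j = j} {q = q} {p = p} {i = i} j∉q p⊆q eq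
  with x∈p∪q⁻ p ⁅ i ⁆ (subst (j ∈ₛ_) (sym eq) (x∈p∪⁅x⁆ q j))
... | inj₁ j∈p = ⊥-elim (j∉q (p⊆q j∈p))
... | inj₂ j∈⁅i⁆ = sym (x∈⁅y⁆⇒x≡y i j∈⁅i⁆)

injective∧⊆⇒≤length : {g : Fin m → A} {xs : List A} →
                      Injective _≡_ _≡_ g → (∀ k → g k ∈ xs) → m ≤ length xs
injective∧⊆⇒≤length {g = g} {xs = xs} g-inj g∈xs = injective⇒≤ index-inj
  where
  open ≡-Reasoning
  index-inj : Injective _≡_ _≡_ (Any.index ∘ g∈xs)
  index-inj {a} {b} eq = g-inj (begin
    g a                            ≡⟨ lookup-index (g∈xs a) ⟩
    lookup xs (Any.index (g∈xs a)) ≡⟨ cong (lookup xs) eq ⟩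
    lookup xs (Any.index (g∈xs b)) ≡⟨ sym (lookup-index (g∈xs b)) ⟩
    g b                            ∎)

≼K-antisym : {x y : KElem s t} → x ≼K y → y ≼K x → x ≡ y
≼K-antisym ≼-refl _ = refl

lower≼lower⇒≡ : {j j′ : Fin t} → inj₂ j ≼K inj₂ {A = Fin s} j′ → j ≡ j′
lower≼lower⇒≡ ≼-refl = refl

other : Fin 2 → Fin 2
other zero = suc zero
other (suc zero) = zero

other≢ : ∀ j → other j ≢ j
other≢ zero ()
other≢ (suc zero) ()

no-least : (x : KElem s 2) → ∃ λ y → ¬ x ≼K y
no-least (inj₁ k) = inj₂ zero , λ ()
no-least (inj₂ j) = inj₂ (other j) , other≢ j ∘ sym ∘ lower≼lower⇒≡

IsOrderEmbedding : (KElem s t → Subset n) → Set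
IsOrderEmbedding f = ∀ x y → f x ⊆ f y ⇔ x ≼K y

Antichain : (Fin t → Subset n) → Set
Antichain L = ∀ {j j′} → L j ⊆ L j′ → j ≡ j′

module _ {f : KElem s t → Subset n} (f-emb : IsOrderEmbedding f) where

  embedding-injective : Injective _≡_ _≡_ f
  embedding-injective {x} {y} fx≡fy =
    ≼K-antisym (to (f-emb x y) (⊆-reflexive fx≡fy)) (to (f-emb y x) (⊆-reflexive (sym fx≡fy)))

  lower⊆upper : ∀ j k → f (inj₂ j) ⊆ f (inj₁ k)
  lower⊆upper j k = from (f-emb (inj₂ j) (inj₁ k)) ≼-low-up

  lowers-antichain : Antichain (f ∘ inj₂)
  lowers-antichain L⊆L′ = lower≼lower⇒≡ (to (f-emb _ _) L⊆L′)

  embedding⇒copy : {F : Family n} → (∀ x → f x ∈ F) → ContainsInducedK s t F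
  embedding⇒copy f∈F = f , f∈F , embedding-injective , f-emb

  others∈F : {F : Family n} {x y : KElem s t} → (∀ z → f z ∈ f x ∷ F) → y ≢ x → f y ∈ F
  others∈F {y = y} f∈ y≢x = Any.tail (y≢x ∘ embedding-injective) (f∈ y)

pair : A → A → Fin 2 → A
pair a b zero = a
pair a b (suc zero) = b

pair-antichain : p ⊈ q → q ⊈ p → Antichain (pair p q)
pair-antichain p⊈q q⊈p {zero} {zero} _ = refl
pair-antichain p⊈q q⊈p {zero} {suc zero} p⊆q = ⊥-elim (p⊈q p⊆q)
pair-antichain p⊈q q⊈p {suc zero} {zero} q⊆p = ⊥-elim (q⊈p q⊆p)
pair-antichain p⊈q q⊈p {suc zero} {suc zero} _ = refl

replace-lowers : {f : KElem s 2 → Subset n} {L : Fin 2 → Subset n} →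
                 IsOrderEmbedding f → Antichain L → (∀ j k → L j ⊆ f (inj₁ k)) →
                 IsOrderEmbedding [ f ∘ inj₁ , L ]′
replace-lowers f-emb L-anti L⊆U (inj₁ k) (inj₁ k′) = f-emb (inj₁ k) (inj₁ k′)
replace-lowers f-emb L-anti L⊆U (inj₂ j) (inj₁ k) = mk⇔ (λ _ → ≼-low-up) (λ _ {x} → L⊆U j k {x})
replace-lowers f-emb L-anti L⊆U (inj₁ k) (inj₂ j) =
  mk⇔ (λ U⊆L → ⊥-elim (other≢ j (L-anti (λ x∈L → U⊆L (L⊆U (other j) k x∈L))))) (λ ())
replace-lowers {L = L} f-emb L-anti L⊆U (inj₂ j) (inj₂ j′) = mk⇔ to′ (λ { ≼-refl → ⊆-refl })
  where
  to′ : L j ⊆ L j′ → inj₂ j ≼K inj₂ j′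
  to′ L⊆L′ with L-anti L⊆L′
  ... | refl = ≼-refl

lowers-incomparable : {f : KElem s 2 → Subset n} → IsOrderEmbedding f →
                      ¬ Comparable (f (inj₂ zero)) (f (inj₂ (suc zero)))
lowers-incomparable f-emb (inj₁ L₀⊆L₁) with () ← lowers-antichain f-emb L₀⊆L₁
lowers-incomparable f-emb (inj₂ L₁⊆L₀) with () ← lowers-antichain f-emb L₁⊆L₀

ChainBelow : Family n → Subset n → Set
ChainBelow F p = ∀ {G H} → G ∈ F → H ∈ F → G ⊆ p → H ⊆ p → Comparable G H

chainBelow-anti : {F : Family n} → p ⊆ q → ChainBelow F q → ChainBelow F p
chainBelow-anti p⊆q chain G∈F H∈F G⊆p H⊆p =
  chain G∈F H∈F (λ x∈G → p⊆q (G⊆p x∈G)) (λ x∈H → p⊆q (H⊆p x∈H))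

chainBelow-⁅⁆ : {F : Family n} → ChainBelow F ⁅ i ⁆
chainBelow-⁅⁆ _ _ = ⊆⁅⁆⇒comparable

module _ {F : Family n} (K-free : ¬ ContainsInducedK s 2 F) where

  chainBelow-lowers : {f : KElem s 2 → Subset n} → IsOrderEmbedding f →
                      (∀ k → f (inj₁ k) ∈ F) → ChainBelow F (f (inj₂ zero) ∪ f (inj₂ (suc zero)))
  chainBelow-lowers {f = f} f-emb U∈F {G} {H} G∈F H∈F G⊆M H⊆M with G ⊆? H | H ⊆? G
  ... | yes G⊆H | _ = inj₁ G⊆H
  ... | no _ | yes H⊆G = inj₂ H⊆G
  ... | no G⊈H | no H⊈G =
    ⊥-elim (K-free (embedding⇒copy (replace-lowers f-emb (pair-antichain G⊈H H⊈G) below) in-F))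
    where
    M⊆U : ∀ k → f (inj₂ zero) ∪ f (inj₂ (suc zero)) ⊆ f (inj₁ k)
    M⊆U k = ∪-least (lower⊆upper f-emb zero k) (lower⊆upper f-emb (suc zero) k)
    below : ∀ j k → pair G H j ⊆ f (inj₁ k)
    below zero k x∈G = M⊆U k (G⊆M x∈G)
    below (suc zero) k x∈H = M⊆U k (H⊆M x∈H)
    in-F : ∀ x → [ f ∘ inj₁ , pair G H ]′ x ∈ F
    in-F (inj₁ k) = U∈F k
    in-F (inj₂ zero) = G∈F
    in-F (inj₂ (suc zero)) = H∈F

  embedding-meets : {f : KElem s 2 → Subset n} {B : Subset n} → IsOrderEmbedding f →
                    (∀ x → f x ∈ B ∷ F) → ∃ λ x → f x ≡ B
  embedding-meets {f = f} {B} f-emb f∈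
    with any? (λ k → f (inj₁ k) ≟ₛ B) | any? (λ j → f (inj₂ j) ≟ₛ B)
  ... | yes (k , fk≡B) | _ = inj₁ k , fk≡B
  ... | no _ | yes (j , fj≡B) = inj₂ j , fj≡B
  ... | no U≢B | no L≢B = ⊥-elim (K-free (embedding⇒copy f-emb f∈F))
    where
    f∈F : ∀ x → f x ∈ F
    f∈F (inj₁ k) = Any.tail (λ fk≡B → U≢B (k , fk≡B)) (f∈ (inj₁ k))
    f∈F (inj₂ j) = Any.tail (λ fj≡B → L≢B (j , fj≡B)) (f∈ (inj₂ j))

  module _ (saturated : ∀ B → B ∉ F → ContainsInducedK s 2 (B ∷ F)) where

    ∅∈F : ∅ ∈ F
    ∅∈F with ∅ ∈ᶠ? F
    ... | yes ∅∈F = ∅∈F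
    ... | no ∅∉F with saturated ∅ ∅∉F
    ...   | f , f∈ , _ , f-emb with embedding-meets f-emb f∈
    ...     | x , fx≡∅ with no-least x
    ...       | y , x⋠y =
      ⊥-elim (x⋠y (to (f-emb x y) (λ z∈fx → ⊆-min (f y) (subst (_ ∈ₛ_) fx≡∅ z∈fx))))

    Partner : Subset n → Set
    Partner B = ∃ λ C → C ∈ F × B ⊈ C × C ⊈ B × ChainBelow F (B ∪ C)

    -- The added set is a lower element (as an upper one, the two lowers below it
    -- would be comparable), and its partner is the other lower.
    partner : {B : Subset n} → B ∉ F → ChainBelow F B → Partner B
    partner {B} B∉F chain with saturated B B∉F
    ... | f , f∈ , _ , f-emb with embedding-meets f-emb f∈
    ... | inj₁ k , refl =
      ⊥-elim (lowers-incomparable f-emb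
        (chain (others∈F f-emb f∈ λ ()) (others∈F f-emb f∈ λ ())
               (lower⊆upper f-emb zero k) (lower⊆upper f-emb (suc zero) k)))
    ... | inj₂ j , refl =
        f (inj₂ (other j))
      , others∈F f-emb f∈ (other≢ j ∘ inj₂-injective)
      , other≢ j ∘ sym ∘ lowers-antichain f-emb
      , other≢ j ∘ lowers-antichain f-emb
      , chainBelow-anti (∪-least (lower⊆lowers j) (lower⊆lowers (other j)))
                        (chainBelow-lowers f-emb (λ k → others∈F f-emb f∈ λ ()))
      where
      lower⊆lowers : ∀ j → f (inj₂ j) ⊆ f (inj₂ zero) ∪ f (inj₂ (suc zero))
      lower⊆lowers zero = p⊆p∪q (f (inj₂ (suc zero)))
      lower⊆lowers (suc zero) = q⊆p∪q (f (inj₂ zero)) (f (inj₂ (suc zero)))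

    Extendable : Fin n → Subset n → Set
    Extendable i Y = Y ∈ F × i ∉ₛ Y × ChainBelow F (Y ∪ ⁅ i ⁆)

    extendable-∅ : Extendable i ∅
    extendable-∅ {i = i} = ∅∈F , ∉⊥ , chainBelow-anti (⊆-reflexive (∪-identityˡ ⁅ i ⁆)) chainBelow-⁅⁆

    extend : {Y : Subset n} → Extendable i Y → Y ∪ ⁅ i ⁆ ∉ F → ∃ λ Y′ → Y ⊂ Y′ × Extendable i Y′
    extend {i = i} {Y} (Y∈F , i∉Y , chain) B∉F with partner B∉F chain
    ... | C , C∈F , B⊈C , C⊈B , chainBC =
      C , (Y⊆C , ⊈⇒∃∈∉ C⊈Y) , C∈F , i∉C , chainBelow-anti C∪i⊆B∪C chainBC
      where
      B : Subset n
      B = Y ∪ ⁅ i ⁆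
      Y⊆B : Y ⊆ B
      Y⊆B = p⊆p∪q ⁅ i ⁆
      i∈B : i ∈ₛ B
      i∈B = x∈p∪⁅x⁆ Y i
      C⊈Y : C ⊈ Y
      C⊈Y C⊆Y = C⊈B (λ x∈C → Y⊆B (C⊆Y x∈C))
      Y⊆C : Y ⊆ C
      Y⊆C with chainBC Y∈F C∈F (λ x∈Y → p⊆p∪q C (Y⊆B x∈Y)) (q⊆p∪q B C)
      ... | inj₁ Y⊆C = Y⊆C
      ... | inj₂ C⊆Y = ⊥-elim (C⊈Y C⊆Y)
      i∉C : i ∉ₛ C
      i∉C i∈C = B⊈C (∪-least Y⊆C λ x∈⁅i⁆ → subst (_∈ₛ C) (sym (x∈⁅y⁆⇒x≡y i x∈⁅i⁆)) i∈C)
      C∪i⊆B∪C : C ∪ ⁅ i ⁆ ⊆ B ∪ C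
      C∪i⊆B∪C = ∪-least (q⊆p∪q B C) λ x∈⁅i⁆ →
        p⊆p∪q C (subst (_∈ₛ B) (sym (x∈⁅y⁆⇒x≡y i x∈⁅i⁆)) i∈B)

    Witness : Fin n → Set
    Witness i = ∃ λ Y → Extendable i Y × Y ∪ ⁅ i ⁆ ∈ F

    saturate : {Y : Subset n} → Acc _⊃_ Y → Extendable i Y → Witness i
    saturate {i = i} {Y} (acc rs) ext with (Y ∪ ⁅ i ⁆) ∈ᶠ? F
    ... | yes B∈F = Y , ext , B∈F
    ... | no B∉F with extend ext B∉F
    ...   | Y′ , Y⊂Y′ , ext′ = saturate (rs Y⊂Y′) ext′

    witness : ∀ i → Witness i
    witness i = saturate (⊃-wellFounded ∅) extendable-∅

    members : Fin (suc n) → Subset n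
    members zero = ∅
    members (suc i) = proj₁ (witness i) ∪ ⁅ i ⁆

    members∈F : ∀ k → members k ∈ F
    members∈F zero = ∅∈F
    members∈F (suc i) = proj₂ (proj₂ (witness i))

    members-injective : Injective _≡_ _≡_ members
    members-injective {zero} {zero} _ = refl
    members-injective {zero} {suc j} ∅≡ = ⊥-elim (∉⊥ (subst (j ∈ₛ_) (sym ∅≡) (x∈p∪⁅x⁆ _ j)))
    members-injective {suc i} {zero} ≡∅ = ⊥-elim (∉⊥ (subst (i ∈ₛ_) ≡∅ (x∈p∪⁅x⁆ _ i)))
    members-injective {suc i} {suc j} eq with witness i | witness j
    ... | Yᵢ , (Yᵢ∈F , i∉Yᵢ , chain) , _ | Yⱼ , (Yⱼ∈F , j∉Yⱼ , _) , _
      with chain Yᵢ∈F Yⱼ∈F (p⊆p∪q ⁅ i ⁆) (λ x∈Yⱼ → subst (_ ∈ₛ_) (sym eq) (p⊆p∪q ⁅ j ⁆ x∈Yⱼ))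
    ...   | inj₁ Yᵢ⊆Yⱼ = cong suc (∪⁅⁆≡∪⁅⁆⇒≡ j∉Yⱼ Yᵢ⊆Yⱼ eq)
    ...   | inj₂ Yⱼ⊆Yᵢ = cong suc (sym (∪⁅⁆≡∪⁅⁆⇒≡ i∉Yᵢ Yⱼ⊆Yᵢ (sym eq)))

    n<∣F∣ : suc n ≤ length F
    n<∣F∣ = injective∧⊆⇒≤length members-injective members∈F

theorem2 : (n s : ℕ) (F : Family n) → Unique F → InducedSaturated s 2 F →
    suc n ≤ length F
theorem2 n s F _ (K-free , saturated) = n<∣F∣ K-free saturated
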